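{- For every positive integer $n$, $l_1(n)=a_1(n)=2^{n-1}$.
   Context: The triangle $T_m$ (rotation number $m$) is the array whose row $x$ ($x=1,2,\dots$) has $x$ entries in columns $0,\dots,x-1$, defined by $T_m(1,0)=1$; for $x>1$ and $0\le c\le x-2$, $T_m(x,c)=T_m(x-1,c+m)$; and $T_m(x,x-1)=1+T_m(x-1,0)$, where $T_m(x,c)$ for any integer $c$ denotes the entry in row $x$, column ($c$ mod $x$). Define $l_m(1)=1$ and $l_m(n)=\min\{x>l_m(n-1): T_m(x,0)=1\}$ for $n\ge2$ (the rows headed by $1$), and $a_m(n)=\min\{x\in\mathbb{N}: T_m(x,x-1)=n\}$ (the row in which $n$ first appears). -}

module Defs where

open import Data.Nat using (ℕ; zero; suc; _+_; _∸_; _<_; _≤_; _<ᵇ_)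
open import Data.Nat.DivMod using (_%_)
open import Data.Bool using (if_then_else_)
open import Data.Product using (Σ; _×_)
open import Data.Empty using (⊥)
open import Relation.Binary.PropositionalEquality using (_≡_)

-- row m k c  =  T_m(k+1, c mod (k+1))   (row index shifted by one: row x = k+1)
--   T_m(1,0) = 1
--   for x = k+2:  column c' = c mod x;
--     c' ≤ x-2 (i.e. c' < k+1)  ↦  T_m(x-1, c'+m)   (reduced mod x-1 by the recursive call)
--     c' = x-1                 ↦  1 + T_m(x-1, 0)
row : ℕ → ℕ → ℕ → ℕ
row m zero    c = 1
row m (suc k) c =
  let c' = c % suc (suc k) in
  if c' <ᵇ suc k then row m k (c' + m) else suc (row m k 0)

-- T m x c = T_m(x, c mod x) for rows x ≥ 1 (the value at x = 0 is meaningless)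
T : ℕ → ℕ → ℕ → ℕ
T m zero    c = 0
T m (suc k) c = row m k c

IsLeast : (ℕ → Set) → ℕ → Set
IsLeast P x = P x × (∀ y → P y → x ≤ y)

-- IsL m n x  :⇔  l_m(n) is defined and equals x
--   l_m(1) = 1,  l_m(n) = min{ x > l_m(n-1) : T_m(x,0) = 1 }
IsL : ℕ → ℕ → ℕ → Set
IsL m zero          x = ⊥
IsL m (suc zero)    x = x ≡ 1
IsL m (suc (suc n)) x =
  Σ ℕ (λ y → IsL m (suc n) y × IsLeast (λ z → y < z × T m z 0 ≡ 1) x)

IsA : ℕ → ℕ → ℕ → Set
IsA m n x = IsLeast (λ z → 1 ≤ z × T m z (z ∸ 1) ≡ n) x

{-# OPTIONS --safe #-}
module Submission where

open import Defs
open import Data.Nat using (ℕ; _≤_; _∸_; _^_)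
open import Data.Product using (_×_)

open import Data.Bool using (Bool; true; false; if_then_else_)
open import Data.Empty using (⊥-elim)
open import Data.List using (List; []; _∷_)
open import Data.Nat using (zero; suc; _+_; _<_; _<ᵇ_; NonZero; z≤n; s≤s; z<s)
open import Data.Nat.Properties
open import Data.Nat.DivMod using (_%_; n%1≡0; n%n≡0; m%n<n; m<n⇒m%n≡m)
open import Data.Nat.Induction using (<-rec)
open import Data.Product using (∃; _,_)
open import Data.Sum using (inj₁; inj₂)
open import Function using (_∘′_)
open import Relation.Binary.PropositionalEquality
open import Relation.Nullary.Reflects using (ofʸ; ofⁿ)

-- Row x of T₁ lists the binary digit sums of x, x+1, …, 2x−1 read cyclically:
-- T₁(x, c) = s₂(x + c mod x). The invariant survives the passage from row x to
-- row x+1 because s₂(2x) = s₂(x), which is exactly what the wrap-around to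
-- column 0 requires. So the rows headed by 1 are the powers of two, and the
-- last entry T₁(x, x−1) = s₂(2x−1) = 1 + s₂(x−1) first equals n when x − 1 is
-- the least number with n − 1 binary ones, namely 2^(n−1) − 1.

increment : List Bool → List Bool
increment []           = true ∷ []
increment (false ∷ bs) = true ∷ bs
increment (true  ∷ bs) = false ∷ increment bs

-- least significant bit first
bits : ℕ → List Bool
bits zero    = []
bits (suc n) = increment (bits n)

ones : List Bool → ℕ
ones []           = 0
ones (false ∷ bs) = ones bs
ones (true  ∷ bs) = suc (ones bs)

popcount : ℕ → ℕ
popcount n = ones (bits n)

bits-suc-double : ∀ n → bits (suc (n + n)) ≡ true ∷ bits n
bits-suc-double zero = refl
bits-suc-double (suc n) rewrite +-suc n n | bits-suc-double n = refl

bits-double-suc : ∀ n → bits (suc n + suc n) ≡ false ∷ bits (suc n)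
bits-double-suc n rewrite +-suc n n | bits-suc-double n = refl

popcount-double : ∀ n → popcount (n + n) ≡ popcount n
popcount-double zero    = refl
popcount-double (suc n) = cong ones (bits-double-suc n)

popcount-suc-double : ∀ n → popcount (suc (n + n)) ≡ suc (popcount n)
popcount-suc-double n = cong ones (bits-suc-double n)

data Halving : ℕ → Set where
  even : ∀ n → Halving (n + n)
  odd  : ∀ n → Halving (suc (n + n))

halving : ∀ n → Halving n
halving zero = even 0
halving (suc n) with halving n
... | even m = odd m
... | odd  m = subst Halving (cong suc (+-suc m m)) (even (suc m))

binary-induction : (P : ℕ → Set) → P 0 →
                   (∀ n → P n → P (n + n)) → (∀ n → P n → P (suc (n + n))) →
                   ∀ n → P n
binary-induction P p₀ pᵉ pᵒ = <-rec P step
  where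
  step : ∀ n → (∀ {m} → m < n → P m) → P n
  step n ih with halving n
  ... | even zero    = p₀
  ... | even (suc m) = pᵉ (suc m) (ih (m<m+n (suc m) z<s))
  ... | odd  m       = pᵒ m (ih (s≤s (m≤m+n m m)))

2^-suc : ∀ j → 2 ^ suc j ≡ 2 ^ j + 2 ^ j
2^-suc j = cong (2 ^ j +_) (+-identityʳ (2 ^ j))

^-cancelʳ-< : ∀ m .{{_ : NonZero m}} {n o} → m ^ n < m ^ o → n < o
^-cancelʳ-< m mⁿ<mᵒ = ≰⇒> (λ o≤n → <⇒≱ mⁿ<mᵒ (^-monoʳ-≤ m o≤n))

popcount≡0⇒≡0 : ∀ n → popcount n ≡ 0 → n ≡ 0
popcount≡0⇒≡0 =
  binary-induction (λ n → popcount n ≡ 0 → n ≡ 0) (λ _ → refl) double suc-double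
  where
  double : ∀ n → (popcount n ≡ 0 → n ≡ 0) → popcount (n + n) ≡ 0 → n + n ≡ 0
  double n ih p = cong (λ k → k + k) (ih (trans (sym (popcount-double n)) p))

  suc-double : ∀ n → (popcount n ≡ 0 → n ≡ 0) →
               popcount (suc (n + n)) ≡ 0 → suc (n + n) ≡ 0
  suc-double n _ p = ⊥-elim (1+n≢0 (trans (sym (popcount-suc-double n)) p))

popcount≡1⇒≡2^ : ∀ n → popcount n ≡ 1 → ∃ λ j → n ≡ 2 ^ j
popcount≡1⇒≡2^ = binary-induction PowerOfTwoIfOne (λ ()) double suc-double
  where
  PowerOfTwoIfOne : ℕ → Set
  PowerOfTwoIfOne n = popcount n ≡ 1 → ∃ λ j → n ≡ 2 ^ j

  double : ∀ n → PowerOfTwoIfOne n → PowerOfTwoIfOne (n + n)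
  double n ih p with ih (trans (sym (popcount-double n)) p)
  ... | j , refl = suc j , sym (2^-suc j)

  suc-double : ∀ n → PowerOfTwoIfOne n → PowerOfTwoIfOne (suc (n + n))
  suc-double n _ p with popcount≡0⇒≡0 n (suc-injective (trans (sym (popcount-suc-double n)) p))
  ... | refl = 0 , refl

2^popcount≤suc : ∀ n → 2 ^ popcount n ≤ suc n
2^popcount≤suc = binary-induction (λ n → 2 ^ popcount n ≤ suc n) ≤-refl double suc-double
  where
  double : ∀ n → 2 ^ popcount n ≤ suc n → 2 ^ popcount (n + n) ≤ suc (n + n)
  double n ih rewrite popcount-double n = ≤-trans ih (s≤s (m≤m+n n n))

  suc-double : ∀ n → 2 ^ popcount n ≤ suc n → 2 ^ popcount (suc (n + n)) ≤ suc (suc (n + n))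
  suc-double n ih rewrite popcount-suc-double n | 2^-suc (popcount n) | sym (+-suc n n) =
    +-mono-≤ ih ih

popcount-2^ : ∀ j → popcount (2 ^ j) ≡ 1
popcount-2^ zero    = refl
popcount-2^ (suc j) rewrite 2^-suc j | popcount-double (2 ^ j) = popcount-2^ j

popcount-2^∸1 : ∀ j → popcount (2 ^ j ∸ 1) ≡ j
popcount-2^∸1 zero    = refl
popcount-2^∸1 (suc j) rewrite 2^-suc j = go (2 ^ j) (m^n>0 2 j) (popcount-2^∸1 j)
  where
  go : ∀ x → 0 < x → popcount (x ∸ 1) ≡ j → popcount (x + x ∸ 1) ≡ suc j
  go (suc y) _ ih rewrite +-suc y y = trans (popcount-suc-double y) (cong suc ih)

popcount[x+c%x]≡popcount[x+c] : ∀ x c .{{_ : NonZero x}} → c ≤ x →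
                                 popcount (x + c % x) ≡ popcount (x + c)
popcount[x+c%x]≡popcount[x+c] x c c≤x with m≤n⇒m<n∨m≡n c≤x
... | inj₁ c<x  = cong (λ r → popcount (x + r)) (m<n⇒m%n≡m c<x)
... | inj₂ refl = begin
  popcount (x + x % x) ≡⟨ cong (λ r → popcount (x + r)) (n%n≡0 x) ⟩
  popcount (x + 0)     ≡⟨ cong popcount (+-identityʳ x) ⟩
  popcount x           ≡⟨ popcount-double x ⟨
  popcount (x + x)     ∎
  where open ≡-Reasoning

T₁≡popcount : ∀ k c → T 1 (suc k) c ≡ popcount (suc k + c % suc k)
T₁≡popcount zero    c rewrite n%1≡0 c = refl
T₁≡popcount (suc k) c = step (c % suc (suc k)) (m%n<n c (suc (suc k)))
  where
  open ≡-Reasoning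
  step : ∀ c′ → c′ < suc (suc k) →
         (if c′ <ᵇ suc k then row 1 k (c′ + 1) else suc (row 1 k 0)) ≡ popcount (suc (suc k) + c′)
  step c′ _ with c′ <ᵇ suc k | <ᵇ-reflects-< c′ (suc k)
  ... | true | ofʸ c′<k+1 = begin
    row 1 k (c′ + 1)                     ≡⟨ T₁≡popcount k (c′ + 1) ⟩
    popcount (suc k + (c′ + 1) % suc k)  ≡⟨ popcount[x+c%x]≡popcount[x+c] (suc k) (c′ + 1) c′+1≤k+1 ⟩
    popcount (suc k + (c′ + 1))          ≡⟨ cong (λ r → popcount (suc k + r)) (+-comm c′ 1) ⟩
    popcount (suc k + suc c′)            ≡⟨ cong popcount (+-suc (suc k) c′) ⟩
    popcount (suc (suc k) + c′)          ∎
    where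
    c′+1≤k+1 : c′ + 1 ≤ suc k
    c′+1≤k+1 = ≤-trans (≤-reflexive (+-comm c′ 1)) c′<k+1
  step c′ c′<k+2 | false | ofⁿ c′≮k+1 with ≤-antisym (≤-pred c′<k+2) (≮⇒≥ c′≮k+1)
  ... | refl = begin
    suc (row 1 k 0)                 ≡⟨ cong suc (T₁≡popcount k 0) ⟩
    suc (popcount (suc k + 0))      ≡⟨ cong (suc ∘′ popcount) (+-identityʳ (suc k)) ⟩
    suc (popcount (suc k))          ≡⟨ popcount-suc-double (suc k) ⟨
    popcount (suc (suc k + suc k))  ∎

T₁-first : ∀ x → T 1 x 0 ≡ popcount x
T₁-first zero    = refl
T₁-first (suc k) = trans (T₁≡popcount k 0) (cong popcount (+-identityʳ (suc k)))

T₁-last : ∀ k → T 1 (suc k) k ≡ suc (popcount k)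
T₁-last k = begin
  T 1 (suc k) k                  ≡⟨ T₁≡popcount k k ⟩
  popcount (suc k + k % suc k)   ≡⟨ cong (λ r → popcount (suc k + r)) (m<n⇒m%n≡m (n<1+n k)) ⟩
  popcount (suc (k + k))         ≡⟨ popcount-suc-double k ⟩
  suc (popcount k)               ∎
  where open ≡-Reasoning

l₁≡2^ : ∀ n → IsL 1 (suc n) (2 ^ n)
l₁≡2^ zero    = refl
l₁≡2^ (suc n) = 2 ^ n , l₁≡2^ n , (2ⁿ<2ⁿ⁺¹ , head≡1) , least
  where
  2ⁿ<2ⁿ⁺¹ : 2 ^ n < 2 ^ suc n
  2ⁿ<2ⁿ⁺¹ = ^-monoʳ-< 2 (s≤s (s≤s z≤n)) (n<1+n n)

  head≡1 : T 1 (2 ^ suc n) 0 ≡ 1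
  head≡1 = trans (T₁-first (2 ^ suc n)) (popcount-2^ (suc n))

  least : ∀ z → 2 ^ n < z × T 1 z 0 ≡ 1 → 2 ^ suc n ≤ z
  least z (2ⁿ<z , head≡1) with popcount≡1⇒≡2^ z (trans (sym (T₁-first z)) head≡1)
  ... | j , refl = ^-monoʳ-≤ 2 (^-cancelʳ-< 2 {n} {j} 2ⁿ<z)

a₁≡2^ : ∀ n → IsA 1 (suc n) (2 ^ n)
a₁≡2^ n = (m^n>0 2 n , last-entry (2 ^ n) (m^n>0 2 n) (popcount-2^∸1 n)) , least
  where
  last-entry : ∀ x → 0 < x → popcount (x ∸ 1) ≡ n → T 1 x (x ∸ 1) ≡ suc n
  last-entry (suc k) _ p = trans (T₁-last k) (cong suc p)

  least : ∀ z → 1 ≤ z × T 1 z (z ∸ 1) ≡ suc n → 2 ^ n ≤ z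
  least (suc k) (_ , last≡n+1) = subst (λ m → 2 ^ m ≤ suc k) popcount≡n (2^popcount≤suc k)
    where
    popcount≡n : popcount k ≡ n
    popcount≡n = suc-injective (trans (sym (T₁-last k)) last≡n+1)

proposition13 : (n : ℕ) → 1 ≤ n → IsL 1 n (2 ^ (n ∸ 1)) × IsA 1 n (2 ^ (n ∸ 1))
proposition13 (suc n) _ = l₁≡2^ n , a₁≡2^ n
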